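{- Finitely describable partial involutions on $T_{\Sigma}$ are not closed under linear application: there exist finitely describable partial involutions $f, g$ such that $f \cdot g$ is not finitely describable.
   Context: $\Sigma$ is the signature with one constant $\varepsilon$, unary symbols $l, r$, binary symbol $p$; $T_{\Sigma}$ denotes ground terms and $T_{\Sigma}(X)$ terms over a set of variables $X$. A partial injective function $f$ on $T_{\Sigma}$ is a partial involution if it equals its relational converse. $f$ is finitely describable if there is a finite family $\{(t_i,u_i) \mid 1 \le i \le k\}$ with $t_i,u_i \in T_{\Sigma}(X)$ such that the graph of $f$ is the symmetric closure of $\{(\sigma(t_i),\sigma(u_i)) \mid \sigma : X \to T_{\Sigma} \text{ a ground substitution},\ 1 \le i \le k\}$. Linear application: identifying partial functions with their graphs, writing $f;g$ for relational composition in diagrammatic order and $h^{\ast}$ for reflexive–transitive closure, let $f_{ij} = \{(u,v) \mid (i(u),j(v)) \in f\}$ for $i,j\in\{l,r\}$ and $f \cdot g = f_{rr} \cup f_{rl};g;(f_{ll};g)^{\ast};f_{lr}$. -}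

module Defs where

open import Data.Nat using (ℕ)
open import Data.List using (List)
open import Data.List.Membership.Propositional using (_∈_)
open import Data.Product using (Σ; ∃; ∃-syntax; _×_; _,_)
open import Data.Sum using (_⊎_)
open import Relation.Binary.PropositionalEquality using (_≡_)
open import Relation.Binary.Construct.Closure.ReflexiveTransitive using (Star)
open import Function.Bundles using (_⇔_)

data TΣ : Set where
  ε : TΣ
  l : TΣ → TΣ
  r : TΣ → TΣ
  p : TΣ → TΣ → TΣ

data TΣX : Set where
  var : ℕ → TΣX
  ε′  : TΣX
  l′  : TΣX → TΣX
  r′  : TΣX → TΣX
  p′  : TΣX → TΣX → TΣX

_[_] : TΣX → (ℕ → TΣ) → TΣ
var x    [ σ ] = σ x
ε′       [ σ ] = ε
l′ t     [ σ ] = l (t [ σ ])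
r′ t     [ σ ] = r (t [ σ ])
p′ t u   [ σ ] = p (t [ σ ]) (u [ σ ])

-- Partial functions are identified with their graphs (binary relations on TΣ)
Graph : Set₁
Graph = TΣ → TΣ → Set

IsPartialInvolution : Graph → Set
IsPartialInvolution f =
  (∀ {a b c} → f a b → f a c → b ≡ c) ×
  (∀ {a b c} → f a c → f b c → a ≡ b) ×
  (∀ {a b} → f a b → f b a)

Generated : List (TΣX × TΣX) → Graph
Generated F a b =
  ∃[ t ] ∃[ u ] ∃[ σ ] ((t , u) ∈ F ×
    ((a ≡ t [ σ ] × b ≡ u [ σ ]) ⊎ (a ≡ u [ σ ] × b ≡ t [ σ ])))

FinitelyDescribable : Graph → Set
FinitelyDescribable f =
  ∃[ F ] (∀ a b → f a b ⇔ Generated F a b)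

_∪_ : Graph → Graph → Graph
(f ∪ g) a b = f a b ⊎ g a b

_⨾_ : Graph → Graph → Graph
(f ⨾ g) a c = ∃[ b ] (f a b × g b c)

_* : Graph → Graph
f * = Star f

_⟨_,_⟩ : Graph → (TΣ → TΣ) → (TΣ → TΣ) → Graph
f ⟨ i , j ⟩ = λ u v → f (i u) (j v)

_·_ : Graph → Graph → Graph
f · g = (f ⟨ r , r ⟩) ∪ ((((f ⟨ r , l ⟩) ⨾ g) ⨾ (((f ⟨ l , l ⟩) ⨾ g) *)) ⨾ (f ⟨ l , r ⟩))

-- The involutions F and G are chosen so that F · G sends l (lⁿ ε) to r (rⁿ ε): each round
-- of the linear application moves one l from the left argument of a p to the right one,
-- as an r. So the domain of F · G contains terms of every height, yet all of them are
-- p-free. In a finitely describable relation, a pair instantiating a pattern (t , u)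
-- stays related when every variable is replaced by p ε ε; if the domain is p-free, t can
-- then contain no variable at all. So a finitely describable relation with p-free domain
-- has a finite domain.
module Submission where

open import Data.List using (List; []; _∷_; map)
open import Data.List.Extrema.Nat using (max; xs≤max)
open import Data.List.Membership.Propositional using (_∈_; _∉_)
open import Data.List.Membership.Propositional.Properties using (∈-map⁺)
open import Data.List.Relation.Unary.All using (lookup)
open import Data.List.Relation.Unary.Any using (here; there)
open import Data.Nat using (ℕ; zero; suc; _≤_; _⊔_)
open import Data.Nat.GeneralisedArithmetic using (fold; iterate)
open import Data.Nat.Properties using (1+n≰n)
open import Data.Product using (∃-syntax; _×_; _,_; proj₁; proj₂)
open import Data.Sum using (inj₁; inj₂)
open import Function using (const; id; _∘_)
open import Function.Bundles using (_⇔_; mk⇔; module Equivalence)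
open import Relation.Binary.Construct.Closure.ReflexiveTransitive using (Star; _◅_)
  renaming (ε to []*)
open import Relation.Binary.Construct.Closure.Symmetric using (SymClosure; fwd; bwd; symmetric)
open import Relation.Binary.Definitions using (Symmetric)
open import Relation.Binary.PropositionalEquality using (_≡_; refl; cong; sym; subst)
open import Relation.Nullary using (¬_)

open import Defs

open Equivalence using (to; from)

private
  variable
    R : Graph
    a b u v w x y : TΣ

functional∧symmetric⇒involution :
  (∀ {a b c} → R a b → R a c → b ≡ c) → Symmetric R → IsPartialInvolution R
functional∧symmetric⇒involution functional symm =
  functional , (λ Rac Rbc → functional (symm Rac) (symm Rbc)) , symm

Instance : List (TΣX × TΣX) → Graph
Instance F a b = ∃[ t ] ∃[ u ] ∃[ σ ] ((t , u) ∈ F × a ≡ t [ σ ] × b ≡ u [ σ ])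

symClosure-describable :
  (F : List (TΣX × TΣX)) → (∀ {a b} → R a b ⇔ Instance F a b) →
  FinitelyDescribable (SymClosure R)
symClosure-describable {R} F R⇔F = F , λ a b → mk⇔ generated closure
  where
  generated : SymClosure R a b → Generated F a b
  generated (fwd Rab) with to R⇔F Rab
  ... | t , u , σ , tu∈F , a≡ , b≡ = t , u , σ , tu∈F , inj₁ (a≡ , b≡)
  generated (bwd Rba) with to R⇔F Rba
  ... | t , u , σ , tu∈F , b≡ , a≡ = t , u , σ , tu∈F , inj₂ (a≡ , b≡)

  closure : Generated F a b → SymClosure R a b
  closure (t , u , σ , tu∈F , inj₁ (a≡ , b≡)) = fwd (from R⇔F (t , u , σ , tu∈F , a≡ , b≡))
  closure (t , u , σ , tu∈F , inj₂ (a≡ , b≡)) = bwd (from R⇔F (t , u , σ , tu∈F , b≡ , a≡))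

data PFree : TΣ → Set where
  ε : PFree ε
  l : PFree x → PFree (l x)
  r : PFree x → PFree (r x)

close : TΣX → TΣ
close t = t [ const (p ε ε) ]

pFree-close⇒[σ]≡close : ∀ t → PFree (close t) → ∀ σ → t [ σ ] ≡ close t
pFree-close⇒[σ]≡close ε′     ε     σ = refl
pFree-close⇒[σ]≡close (l′ t) (l h) σ = cong l (pFree-close⇒[σ]≡close t h σ)
pFree-close⇒[σ]≡close (r′ t) (r h) σ = cong r (pFree-close⇒[σ]≡close t h σ)

closedSides : List (TΣX × TΣX) → List TΣ
closedSides []            = []
closedSides ((t , u) ∷ F) = close t ∷ close u ∷ closedSides F

∈-closedSides : ∀ {t u F} → (t , u) ∈ F →
                close t ∈ closedSides F × close u ∈ closedSides F
∈-closedSides (here refl) = here refl , there (here refl)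
∈-closedSides {F = _ ∷ _} (there tu∈F) with ∈-closedSides tu∈F
... | t∈ , u∈ = there (there t∈) , there (there u∈)

finitelyDescribable∧pFreeDomain⇒finiteDomain :
  FinitelyDescribable R → (∀ {a b} → R a b → PFree a) →
  ∃[ as ] (∀ {a b} → R a b → a ∈ as)
finitelyDescribable∧pFreeDomain⇒finiteDomain {R} (F , R⇔F) pFree = closedSides F , domain⊆
  where
  pFree-closedSides : ∀ {t u} → (t , u) ∈ F → PFree (close t) × PFree (close u)
  pFree-closedSides tu∈F =
    pFree (from (R⇔F _ _) (_ , _ , _ , tu∈F , inj₁ (refl , refl))) ,
    pFree (from (R⇔F _ _) (_ , _ , _ , tu∈F , inj₂ (refl , refl)))

  instance∈ : ∀ s σ → PFree (close s) → close s ∈ closedSides F → s [ σ ] ∈ closedSides F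
  instance∈ s σ h = subst (_∈ closedSides F) (sym (pFree-close⇒[σ]≡close s h σ))

  domain⊆ : R a b → a ∈ closedSides F
  domain⊆ Rab with to (R⇔F _ _) Rab
  ... | t , u , σ , tu∈F , inj₁ (refl , _) =
    instance∈ t σ (proj₁ (pFree-closedSides tu∈F)) (proj₁ (∈-closedSides tu∈F))
  ... | t , u , σ , tu∈F , inj₂ (refl , _) =
    instance∈ u σ (proj₂ (pFree-closedSides tu∈F)) (proj₂ (∈-closedSides tu∈F))

height : TΣ → ℕ
height ε       = 0
height (l a)   = suc (height a)
height (r a)   = suc (height a)
height (p a b) = suc (height a ⊔ height b)

height-lⁿ : ∀ n → height (fold ε l n) ≡ n
height-lⁿ zero    = refl
height-lⁿ (suc n) = cong suc (height-lⁿ n)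

lⁿ⁺¹-escapes : (as : List TΣ) → ∃[ n ] fold ε l (suc n) ∉ as
lⁿ⁺¹-escapes as = N , λ lᴺ⁺¹∈as → 1+n≰n (subst (_≤ N) (height-lⁿ (suc N)) (bound lᴺ⁺¹∈as))
  where
  N : ℕ
  N = max 0 (map height as)

  bound : a ∈ as → height a ≤ N
  bound = lookup (xs≤max 0 (map height as)) ∘ ∈-map⁺ height

data F-rule : Graph where
  start : ∀ x   → F-rule (r (l x)) (l (p (l x) ε))
  loop  : ∀ x y → F-rule (l (l (p x (r y)))) (l (p x (r y)))
  stop  : ∀ y   → F-rule (l (r (r y))) (r (r y))

data G-rule : Graph where
  transfer : ∀ x y → G-rule (p (l x) y) (l (p x (r y)))
  empty    : ∀ y   → G-rule (p ε y) (r y)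

F G : Graph
F = SymClosure F-rule
G = SymClosure G-rule

F-functional : F a b → F a w → b ≡ w
F-functional (fwd (start _))  (fwd (start _))  = refl
F-functional (fwd (loop _ _)) (fwd (loop _ _)) = refl
F-functional (fwd (stop _))   (fwd (stop _))   = refl
F-functional (bwd (start _))  (bwd (start _))  = refl
F-functional (bwd (loop _ _)) (bwd (loop _ _)) = refl
F-functional (bwd (stop _))   (bwd (stop _))   = refl

G-functional : G a b → G a w → b ≡ w
G-functional (fwd (transfer _ _)) (fwd (transfer _ _)) = refl
G-functional (fwd (empty _))      (fwd (empty _))      = refl
G-functional (bwd (transfer _ _)) (bwd (transfer _ _)) = refl
G-functional (bwd (empty _))      (bwd (empty _))      = refl

assign : TΣ → TΣ → ℕ → TΣ
assign x y zero    = x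
assign x y (suc _) = y

x₀ x₁ : TΣX
x₀ = var 0
x₁ = var 1

F-patterns : List (TΣX × TΣX)
F-patterns =
  (r′ (l′ x₀) , l′ (p′ (l′ x₀) ε′)) ∷
  (l′ (l′ (p′ x₀ (r′ x₁))) , l′ (p′ x₀ (r′ x₁))) ∷
  (l′ (r′ (r′ x₁)) , r′ (r′ x₁)) ∷ []

G-patterns : List (TΣX × TΣX)
G-patterns =
  (p′ (l′ x₀) x₁ , l′ (p′ x₀ (r′ x₁))) ∷
  (p′ ε′ x₁ , r′ x₁) ∷ []

F-rule⇔instance : F-rule a b ⇔ Instance F-patterns a b
F-rule⇔instance = mk⇔ as-instance as-rule
  where
  as-instance : F-rule a b → Instance F-patterns a b
  as-instance (start x)  = _ , _ , assign x x , here refl , refl , refl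
  as-instance (loop x y) = _ , _ , assign x y , there (here refl) , refl , refl
  as-instance (stop y)   = _ , _ , assign y y , there (there (here refl)) , refl , refl

  as-rule : Instance F-patterns a b → F-rule a b
  as-rule (_ , _ , σ , here refl , refl , refl)                 = start (σ 0)
  as-rule (_ , _ , σ , there (here refl) , refl , refl)         = loop (σ 0) (σ 1)
  as-rule (_ , _ , σ , there (there (here refl)) , refl , refl) = stop (σ 1)

G-rule⇔instance : G-rule a b ⇔ Instance G-patterns a b
G-rule⇔instance = mk⇔ as-instance as-rule
  where
  as-instance : G-rule a b → Instance G-patterns a b
  as-instance (transfer x y) = _ , _ , assign x y , here refl , refl , refl
  as-instance (empty y)      = _ , _ , assign y y , there (here refl) , refl , refl

  as-rule : Instance G-patterns a b → G-rule a b
  as-rule (_ , _ , σ , here refl , refl , refl)         = transfer (σ 0) (σ 1)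
  as-rule (_ , _ , σ , there (here refl) , refl , refl) = empty (σ 1)

Round : Graph
Round = (F ⟨ l , l ⟩) ⨾ G

-- The invariant of a run of F · G from u: once an output is produced, u is p-free.
data Pending (u : TΣ) : TΣ → Set where
  shifting-l : (PFree x → PFree u) → Pending u (l (p x y))
  shifting-r : (PFree y → PFree u) → Pending u (p x y)
  done       : PFree u → Pending u (r y)

pending-start : F (r u) (l a) → G a b → Pending u b
pending-start (fwd (start x)) (fwd (transfer .x .ε)) = shifting-l l
pending-start (bwd (stop y))  (bwd (empty .(r y)))   = shifting-r id

pending-round : Pending u a → Round a b → Pending u b
pending-round (shifting-l h) (_ , fwd (loop _ _) , fwd (transfer _ _)) = shifting-l (h ∘ l)
pending-round (shifting-l h) (_ , fwd (loop _ _) , fwd (empty _))      = done (h ε)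
pending-round (shifting-r h) (_ , bwd (loop _ _) , bwd (transfer _ _)) = shifting-r (h ∘ r)

pending-rounds : Pending u a → Star Round a b → Pending u b
pending-rounds pending []*          = pending
pending-rounds pending (ab ◅ rounds) = pending-rounds (pending-round pending ab) rounds

pending-stop : Pending u a → F (l a) (r v) → PFree u
pending-stop (done h)       (fwd (stop _))  = h
pending-stop (shifting-r h) (bwd (start _)) = h ε

F·G-domain-pFree : (F · G) u v → PFree u
F·G-domain-pFree (inj₁ (fwd ()))
F·G-domain-pFree (inj₁ (bwd ()))
F·G-domain-pFree (inj₂ (_ , (_ , (_ , Fstart , Gstart) , rounds) , Fstop)) =
  pending-stop (pending-rounds (pending-start Fstart Gstart) rounds) Fstop

rounds-lⁿ : ∀ n y → Star Round (l (p (fold ε l n) (r y))) (r (r (iterate r y n)))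
rounds-lⁿ zero    y = (_ , fwd (loop ε y) , fwd (empty (r y))) ◅ []*
rounds-lⁿ (suc n) y = (_ , fwd (loop _ y) , fwd (transfer _ (r y))) ◅ rounds-lⁿ n (r y)

F·G-lⁿ⁺¹ : ∀ n → (F · G) (fold ε l (suc n)) (r (iterate r ε n))
F·G-lⁿ⁺¹ n =
  inj₂ (_ , (_ , (_ , fwd (start _) , fwd (transfer _ ε)) , rounds-lⁿ n ε) , fwd (stop _))

mainTheorem5 : ∃[ f ] ∃[ g ] (IsPartialInvolution f × FinitelyDescribable f ×
                 IsPartialInvolution g × FinitelyDescribable g ×
                 ¬ FinitelyDescribable (f · g))
mainTheorem5 =
  F , G ,
  functional∧symmetric⇒involution F-functional (symmetric F-rule) ,
  symClosure-describable F-patterns F-rule⇔instance ,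
  functional∧symmetric⇒involution G-functional (symmetric G-rule) ,
  symClosure-describable G-patterns G-rule⇔instance ,
  F·G-not-describable
  where
  F·G-not-describable : ¬ FinitelyDescribable (F · G)
  F·G-not-describable describable
    with finitelyDescribable∧pFreeDomain⇒finiteDomain describable F·G-domain-pFree
  ... | as , domain⊆as with lⁿ⁺¹-escapes as
  ... | n , lⁿ⁺¹∉as = lⁿ⁺¹∉as (domain⊆as (F·G-lⁿ⁺¹ n))
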